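{- Let $m>n$ with $n\equiv 2\pmod 4$, and let $C$ be a Hamilton cycle of $G(m,n)$. Suppose $b\ge 0$ is an integer such that every cell of columns $2b+1$ and $2b+2$ is a turn of $C$, and that $b$ is the minimal nonnegative integer with this property. Then columns $1,2,\dots,2b$ together contain at least $\max\left(2b,\frac n2+1\right)$ straights of $C$.
   Context: $G(m,n)$ is the graph on cells $\{1,\dots,m\}\times\{1,\dots,n\}$ with $(a,b),(c,d)$ adjacent iff $|a-c|+|b-d|=1$; column $x$ is the set of $n$ cells with first coordinate $x$. A Hamilton cycle is a cycle through every cell. A turn of a cycle is a cell whose two incident cycle edges are one horizontal and one vertical; a straight is a cell of the cycle that is not a turn. -}

module Defs where

open import Data.Nat using (ℕ; zero; suc; _+_; _*_; _≤_; _<_; ∣_-_∣)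
open import Data.Product using (_×_; _,_; proj₁; proj₂; ∃; ∃-syntax)
open import Data.Sum using (_⊎_)
open import Relation.Nullary using (¬_)
open import Relation.Binary.PropositionalEquality using (_≡_)

-- Cells are pairs (x , y) of naturals, 1-indexed as in the paper:
-- the cells of G(m,n) are those with 1 ≤ x ≤ m and 1 ≤ y ≤ n.
-- Column x is the set of cells with first coordinate x.
Cell : Set
Cell = ℕ × ℕ

InGrid : ℕ → ℕ → Cell → Set
InGrid m n (x , y) = (1 ≤ x × x ≤ m) × (1 ≤ y × y ≤ n)

Adj : Cell → Cell → Set
Adj (a , b) (c , d) = ∣ a - c ∣ + ∣ b - d ∣ ≡ 1

record HamiltonCycle (m n : ℕ) : Set where
  field
    C        : ℕ → Cell
    periodic : ∀ k → C (k + m * n) ≡ C k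
    inGrid   : ∀ k → InGrid m n (C k)
    adjacent : ∀ k → Adj (C k) (C (suc k))
    injective : ∀ i j → i < m * n → j < m * n → C i ≡ C j → i ≡ j
    surjective : ∀ c → InGrid m n c → ∃[ k ] (k < m * n × C k ≡ c)

Horizontal : Cell → Cell → Set
Horizontal p q = proj₂ p ≡ proj₂ q

module _ {m n : ℕ} (H : HamiltonCycle m n) where
  open HamiltonCycle H

  -- The cell at position suc k, whose cycle edges go to C k and C (suc (suc k)),
  -- has one horizontal and one vertical incident cycle edge.
  TurnAt : ℕ → Set
  TurnAt k = (Horizontal (C k) (C (suc k)) × ¬ Horizontal (C (suc k)) (C (suc (suc k))))
           ⊎ (¬ Horizontal (C k) (C (suc k)) × Horizontal (C (suc k)) (C (suc (suc k))))

  Turn : Cell → Set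
  Turn c = ∃[ k ] (C (suc k) ≡ c × TurnAt k)

  Straight : Cell → Set
  Straight c = InGrid m n c × ¬ Turn c

  TurnColumns : ℕ → Set
  TurnColumns b = ∀ y → 1 ≤ y → y ≤ n →
    Turn (2 * b + 1 , y) × Turn (2 * b + 2 , y)

-- In a column, a cell is straight exactly when the vertical cycle edges just below and just above
-- it are both present or both absent.  No such edge leaves the grid at the bottom or at the top,
-- so, n being even, every column contains an even number of straights.  By minimality of b, each
-- pair of columns 2i+1, 2i+2 with i < b contains a straight, hence at least two: 2b straights in
-- all.  If rows 2i+1, 2i+2 had no straight in columns 1, …, 2b, the turns along these rows from
-- the left border and up the all-turn columns 2b+1, 2b+2 from the bottom border would put the
-- four sides of the unit square with corner (2b+1, 2i+1) on the cycle, impossible for a Hamilton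
-- cycle on more than four cells.  This gives n/2 straights; as their total is even and n/2 is odd,
-- there are at least n/2 + 1.

module Submission where

open import Defs
import Algebra.Properties.CommutativeSemigroup as CommutativeSemigroupProperties
open import Data.Bool using (Bool; true; false; not; _xor_; T)
open import Data.Empty using (⊥; ⊥-elim)
open import Data.List using (List; length; map; filter; downFrom; cartesianProductWith; _++_)
open import Data.List.Properties using (length-++; filter-++)
open import Data.List.Membership.Propositional.Properties using (∈-downFrom⁻)
open import Data.List.Relation.Unary.All as All using (All)
import Data.List.Relation.Unary.All.Properties as Allₚ
open import Data.List.Relation.Unary.Unique.Propositional using (Unique)
import Data.List.Relation.Unary.Unique.Propositional.Properties as Uniqueₚ
open import Data.Nat
  using (ℕ; zero; suc; pred; _+_; _*_; _∸_; _%_; _/_; _⊔_; _≤_; _<_; _≟_; _≤?_; _<?_;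
         z≤n; s≤s; s≤s⁻¹; z<s; ∣_-_∣; NonZero; >-nonZero; parity)
open import Data.Nat.DivMod using (m≡m%n+[m/n]*n; m%n<n; m%n≤m; /-congˡ; m*n/n≡m)
open import Data.Nat.Tactic.RingSolver using (solve-∀)
open import Data.Nat.Properties
open import Data.Parity.Base as ℙ using (Parity; 0ℙ; 1ℙ)
import Data.Parity.Properties as ℙ
open import Data.Product as Product using (_×_; _,_; proj₁; proj₂; ∃-syntax)
open import Data.Sum as Sum using (_⊎_; inj₁; inj₂; [_,_]′)
open import Data.Product.Properties using (≡-dec)
open import Function using (_∘_)
open import Function.Bundles using (_⇔_; mk⇔; module Equivalence)
open import Function.Related.Propositional using (module EquationalReasoning)
open import Function.Properties.Equivalence using ()
  renaming (refl to ⇔-refl; sym to ⇔-sym; trans to ⇔-trans)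
open import Relation.Nullary using (¬_; Dec; yes; no; does; contradiction)
open import Relation.Nullary.Decidable as Dec
  using (_⊎-dec_; _×-dec_; ¬?; map′; T?; dec-false; decidable-stable)
open import Relation.Binary.Definitions using (DecidableEquality)
open import Relation.Unary using (Decidable)
open import Relation.Binary.PropositionalEquality

open CommutativeSemigroupProperties +-commutativeSemigroup using (interchange; x∙yz≈xz∙y)
open CommutativeSemigroupProperties ℙ.+-commutativeSemigroup using (x∙yz≈y∙xz)

-- Sums over initial segments of ℕ

∑< : ℕ → (ℕ → ℕ) → ℕ
∑< zero    f = 0
∑< (suc k) f = ∑< k f + f k

syntax ∑< k (λ i → e) = ∑[ i < k ] e

∑-cong : ∀ k {f g : ℕ → ℕ} → (∀ i → i < k → f i ≡ g i) → ∑< k f ≡ ∑< k g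
∑-cong zero    f≡g = refl
∑-cong (suc k) f≡g = cong₂ _+_ (∑-cong k (λ i i<k → f≡g i (m<n⇒m<1+n i<k))) (f≡g k ≤-refl)

∑-distrib-+ : ∀ k (f g : ℕ → ℕ) → ∑[ i < k ] (f i + g i) ≡ ∑< k f + ∑< k g
∑-distrib-+ zero    f g = refl
∑-distrib-+ (suc k) f g = begin
  ∑[ i < k ] (f i + g i) + (f k + g k) ≡⟨ cong (_+ (f k + g k)) (∑-distrib-+ k f g) ⟩
  ∑< k f + ∑< k g + (f k + g k)        ≡⟨ interchange (∑< k f) (∑< k g) (f k) (g k) ⟩
  ∑< k f + f k + (∑< k g + g k)        ∎
  where open ≡-Reasoning

∑-zero : ∀ k → ∑[ i < k ] 0 ≡ 0
∑-zero zero    = refl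
∑-zero (suc k) = trans (+-identityʳ _) (∑-zero k)

∑-comm : ∀ j k (g : ℕ → ℕ → ℕ) → ∑[ x < j ] ∑[ y < k ] g x y ≡ ∑[ y < k ] ∑[ x < j ] g x y
∑-comm zero    k g = sym (∑-zero k)
∑-comm (suc j) k g = begin
  ∑[ x < j ] ∑[ y < k ] g x y + ∑[ y < k ] g j y ≡⟨ cong (_+ ∑[ y < k ] g j y) (∑-comm j k g) ⟩
  ∑[ y < k ] ∑[ x < j ] g x y + ∑[ y < k ] g j y ≡⟨ ∑-distrib-+ k _ _ ⟨
  ∑[ y < k ] (∑[ x < j ] g x y + g j y)          ∎
  where open ≡-Reasoning

∑-pairs : ∀ p (f : ℕ → ℕ) → ∑< (2 * p) f ≡ ∑[ i < p ] (f (2 * i) + f (suc (2 * i)))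
∑-pairs zero    f = refl
∑-pairs (suc p) f = begin
  ∑< (2 * suc p) f                             ≡⟨ cong (λ k → ∑< k f) (*-suc 2 p) ⟩
  ∑< (2 * p) f + f (2 * p) + f (suc (2 * p))   ≡⟨ +-assoc (∑< (2 * p) f) _ _ ⟩
  ∑< (2 * p) f + (f (2 * p) + f (suc (2 * p))) ≡⟨ cong (_+ (f (2 * p) + f (suc (2 * p)))) (∑-pairs p f) ⟩
  ∑[ i < suc p ] (f (2 * i) + f (suc (2 * i))) ∎
  where open ≡-Reasoning

*≤∑ : ∀ k c (f : ℕ → ℕ) → (∀ i → i < k → c ≤ f i) → k * c ≤ ∑< k f
*≤∑ zero    c f c≤f = z≤n
*≤∑ (suc k) c f c≤f = subst (_≤ ∑< (suc k) f) (+-comm (k * c) c)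
  (+-mono-≤ (*≤∑ k c f (λ i i<k → c≤f i (m<n⇒m<1+n i<k))) (c≤f k ≤-refl))

i<k⇒1+2i<2k : ∀ {i k} → i < k → suc (2 * i) < 2 * k
i<k⇒1+2i<2k {i} {k} i<k = subst (_≤ 2 * k) (*-suc 2 i) (*-monoʳ-≤ 2 i<k)

∑≡0⇒≡0 : ∀ k (f : ℕ → ℕ) → ∑< k f ≡ 0 → ∀ i → i < k → f i ≡ 0
∑≡0⇒≡0 (suc k) f ∑≡0 i i<1+k with m≤n⇒m<n∨m≡n (s≤s⁻¹ i<1+k)
... | inj₁ i<k  = ∑≡0⇒≡0 k f (m+n≡0⇒m≡0 _ ∑≡0) i i<k
... | inj₂ refl = m+n≡0⇒n≡0 (∑< k f) ∑≡0

-- Parity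

toℕ : Bool → ℕ
toℕ false = 0
toℕ true  = 1

bit : Bool → Parity
bit = parity ∘ toℕ

agreements : (ℕ → Bool) → ℕ → ℕ
agreements f k = ∑[ y < k ] toℕ (not (f y xor f (suc y)))

bit-agreement : ∀ a b → bit (not (a xor b)) ℙ.+ bit b ≡ 1ℙ ℙ.+ bit a
bit-agreement false false = refl
bit-agreement false true  = refl
bit-agreement true  false = refl
bit-agreement true  true  = refl

parity-agreements : ∀ f k → parity (agreements f k) ℙ.+ bit (f k) ≡ parity k ℙ.+ bit (f 0)
parity-agreements f zero    = refl
parity-agreements f (suc k) = begin
  parity (A + toℕ a) ℙ.+ bit (f (suc k))   ≡⟨ cong (ℙ._+ bit (f (suc k))) (ℙ.+-homo-+ A (toℕ a)) ⟩
  parity A ℙ.+ bit a ℙ.+ bit (f (suc k))   ≡⟨ ℙ.+-assoc (parity A) (bit a) (bit (f (suc k))) ⟩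
  parity A ℙ.+ (bit a ℙ.+ bit (f (suc k))) ≡⟨ cong (parity A ℙ.+_) (bit-agreement (f k) (f (suc k))) ⟩
  parity A ℙ.+ (1ℙ ℙ.+ bit (f k))          ≡⟨ x∙yz≈y∙xz (parity A) 1ℙ (bit (f k)) ⟩
  1ℙ ℙ.+ (parity A ℙ.+ bit (f k))          ≡⟨ cong (1ℙ ℙ.+_) (parity-agreements f k) ⟩
  1ℙ ℙ.+ (parity k ℙ.+ bit (f 0))          ≡⟨ ℙ.+-assoc 1ℙ (parity k) (bit (f 0)) ⟨
  1ℙ ℙ.+ parity k ℙ.+ bit (f 0)            ≡⟨ cong (ℙ._+ bit (f 0)) (ℙ.+-homo-+ 1 k) ⟨
  parity (suc k) ℙ.+ bit (f 0)             ∎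
  where
  open ≡-Reasoning
  A = agreements f k
  a = not (f k xor f (suc k))

agreements-parity : ∀ f k → f 0 ≡ false → f k ≡ false → parity (agreements f k) ≡ parity k
agreements-parity f k f0≡false fk≡false = begin
  parity (agreements f k)               ≡⟨ ℙ.+-identityʳ _ ⟨
  parity (agreements f k) ℙ.+ bit false ≡⟨ cong (λ b → parity (agreements f k) ℙ.+ bit b) fk≡false ⟨
  parity (agreements f k) ℙ.+ bit (f k) ≡⟨ parity-agreements f k ⟩
  parity k ℙ.+ bit (f 0)                ≡⟨ cong (λ b → parity k ℙ.+ bit b) f0≡false ⟩
  parity k ℙ.+ bit false                ≡⟨ ℙ.+-identityʳ _ ⟩
  parity k                              ∎
  where open ≡-Reasoning

parity-∑ : ∀ k (f : ℕ → ℕ) → (∀ i → i < k → parity (f i) ≡ 0ℙ) → parity (∑< k f) ≡ 0ℙ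
parity-∑ zero    f even = refl
parity-∑ (suc k) f even = begin
  parity (∑< k f + f k)            ≡⟨ ℙ.+-homo-+ (∑< k f) (f k) ⟩
  parity (∑< k f) ℙ.+ parity (f k) ≡⟨ cong₂ ℙ._+_ (parity-∑ k f (λ i i<k → even i (m<n⇒m<1+n i<k)))
                                                   (even k ≤-refl) ⟩
  0ℙ                               ∎
  where open ≡-Reasoning

parity-2* : ∀ p → parity (2 * p) ≡ 0ℙ
parity-2* p = ℙ.*-homo-* 2 p

≤∧parity≢⇒< : ∀ {m n} → m ≤ n → parity m ≢ parity n → m < n
≤∧parity≢⇒< m≤n parity≢ = ≤∧≢⇒< m≤n (parity≢ ∘ cong parity)

n%4≡2⇒n≡2*odd : ∀ n → n % 4 ≡ 2 → n ≡ 2 * (n / 2) × parity (n / 2) ≡ 1ℙ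
n%4≡2⇒n≡2*odd n n%4≡2 = trans n≡2p (cong (2 *_) (sym n/2≡p)) , trans (cong parity n/2≡p) p-odd
  where
  q = n / 4
  p = suc (2 * q)
  n≡2p : n ≡ 2 * p
  n≡2p = begin
    n              ≡⟨ m≡m%n+[m/n]*n n 4 ⟩
    n % 4 + q * 4  ≡⟨ cong (_+ q * 4) n%4≡2 ⟩
    2 + q * 4      ≡⟨ 2+4q≡2[1+2q] q ⟩
    2 * p          ∎
    where
    open ≡-Reasoning
    2+4q≡2[1+2q] : ∀ q → 2 + q * 4 ≡ 2 * suc (2 * q)
    2+4q≡2[1+2q] = solve-∀
  n/2≡p : n / 2 ≡ p
  n/2≡p = trans (/-congˡ (trans n≡2p (*-comm 2 p))) (m*n/n≡m p 2)
  p-odd : parity p ≡ 1ℙ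
  p-odd = trans (ℙ.+-homo-+ 1 (2 * q)) (cong (1ℙ ℙ.+_) (parity-2* q))

-- Alternation

ExactlyOne : Set → Set → Set
ExactlyOne A B = (A × ¬ B) ⊎ (¬ A × B)

module _ {A B : Set} where
  open Equivalence

  exactlyOne-¬A⇒B : ExactlyOne A B → ¬ A → B
  exactlyOne-¬A⇒B (inj₁ (a , _)) ¬a = ⊥-elim (¬a a)
  exactlyOne-¬A⇒B (inj₂ (_ , b)) ¬a = b

  exactlyOne-A⇒¬B : ExactlyOne A B → A → ¬ B
  exactlyOne-A⇒¬B (inj₁ (_ , ¬b)) a = ¬b
  exactlyOne-A⇒¬B (inj₂ (¬a , _)) a = ⊥-elim (¬a a)

  ExactlyOne-cong : ∀ {A′ B′ : Set} → A ⇔ A′ → B ⇔ B′ → ExactlyOne A B ⇔ ExactlyOne A′ B′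
  ExactlyOne-cong A⇔A′ B⇔B′ =
    mk⇔ (transport A⇔A′ B⇔B′) (transport (⇔-sym A⇔A′) (⇔-sym B⇔B′))
    where
    transport : ∀ {A B A′ B′ : Set} → A ⇔ A′ → B ⇔ B′ → ExactlyOne A B → ExactlyOne A′ B′
    transport A⇔A′ B⇔B′ = Sum.map (Product.map (to A⇔A′) (_∘ from B⇔B′))
                                  (Product.map (_∘ from A⇔A′) (to B⇔B′))

T-does : ∀ {A : Set} (a? : Dec A) → T (does a?) ⇔ A
T-does (yes a) = mk⇔ (λ _ → a) _
T-does (no ¬a) = mk⇔ (λ ()) ¬a

toℕ-does≡0⇒¬ : ∀ {A : Set} (a? : Dec A) → toℕ (does a?) ≡ 0 → ¬ A
toℕ-does≡0⇒¬ (no ¬a) _ = ¬a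

T-xor : ∀ {a b} → T (a xor b) ⇔ ExactlyOne (T a) (T b)
T-xor {false} {false} = mk⇔ (λ ()) λ { (inj₁ (() , _)) ; (inj₂ (_ , ())) }
T-xor {false} {true}  = mk⇔ (λ _ → inj₂ ((λ ()) , _)) (λ _ → _)
T-xor {true}  {false} = mk⇔ (λ _ → inj₁ (_ , λ ())) (λ _ → _)
T-xor {true}  {true}  = mk⇔ (λ ()) λ { (inj₁ (_ , ¬b)) → ¬b _ ; (inj₂ (¬a , _)) → ¬a _ }

module Alternation {P : ℕ → Set} {k : ℕ} (¬P0 : ¬ P 0)
                   (alternates : ∀ j → j < k → ExactlyOne (P j) (P (suc j))) where

  alternation-even : ∀ i → 2 * i ≤ k → ¬ P (2 * i)
  alternation-odd  : ∀ i → suc (2 * i) ≤ k → P (suc (2 * i))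

  alternation-even zero    _        = ¬P0
  alternation-even (suc i) 2[1+i]≤k = subst (¬_ ∘ P) (sym (*-suc 2 i))
    (exactlyOne-A⇒¬B (alternates (suc (2 * i)) 2+2i≤k) (alternation-odd i (<⇒≤ 2+2i≤k)))
    where
    2+2i≤k : suc (suc (2 * i)) ≤ k
    2+2i≤k = subst (_≤ k) (*-suc 2 i) 2[1+i]≤k

  alternation-odd i 1+2i≤k =
    exactlyOne-¬A⇒B (alternates (2 * i) 1+2i≤k) (alternation-even i (<⇒≤ 1+2i≤k))

-- Directions in the grid

data Dir : Set where
  L R D U : Dir

_≟ᵈ_ : DecidableEquality Dir
L ≟ᵈ L = yes refl
L ≟ᵈ R = no λ ()
L ≟ᵈ D = no λ ()
L ≟ᵈ U = no λ ()
R ≟ᵈ L = no λ ()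
R ≟ᵈ R = yes refl
R ≟ᵈ D = no λ ()
R ≟ᵈ U = no λ ()
D ≟ᵈ L = no λ ()
D ≟ᵈ R = no λ ()
D ≟ᵈ D = yes refl
D ≟ᵈ U = no λ ()
U ≟ᵈ L = no λ ()
U ≟ᵈ R = no λ ()
U ≟ᵈ D = no λ ()
U ≟ᵈ U = yes refl

-- On coordinate 0, which lies outside the grid, pred gives a junk value; lemmas about step
-- therefore assume positive coordinates.
step : Cell → Dir → Cell
step (x , y) L = (pred x , y)
step (x , y) R = (suc x , y)
step (x , y) D = (x , pred y)
step (x , y) U = (x , suc y)

isHorizontal : Dir → Bool
isHorizontal L = true
isHorizontal R = true
isHorizontal D = false
isHorizontal U = false

data Axis : Set where
  horizontal vertical : Axis

backward forward : Axis → Dir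
backward horizontal = L
backward vertical   = D
forward  horizontal = R
forward  vertical   = U

Axis-elim : {P : Axis → Set} → P horizontal → P vertical → ∀ ax → P ax
Axis-elim p _ horizontal = p
Axis-elim _ p vertical   = p

among? : ∀ a b d → Dec (d ≡ a ⊎ d ≡ b)
among? a b d = (d ≟ᵈ a) ⊎-dec (d ≟ᵈ b)

turn-xor≡along-xor : ∀ a b → a ≢ b → ∀ ax →
  isHorizontal a xor isHorizontal b ≡ does (among? a b (backward ax)) xor does (among? a b (forward ax))
turn-xor≡along-xor L L a≢b = ⊥-elim (a≢b refl)
turn-xor≡along-xor L R _   = Axis-elim refl refl
turn-xor≡along-xor L D _   = Axis-elim refl refl
turn-xor≡along-xor L U _   = Axis-elim refl refl
turn-xor≡along-xor R L _   = Axis-elim refl refl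
turn-xor≡along-xor R R a≢b = ⊥-elim (a≢b refl)
turn-xor≡along-xor R D _   = Axis-elim refl refl
turn-xor≡along-xor R U _   = Axis-elim refl refl
turn-xor≡along-xor D L _   = Axis-elim refl refl
turn-xor≡along-xor D R _   = Axis-elim refl refl
turn-xor≡along-xor D D a≢b = ⊥-elim (a≢b refl)
turn-xor≡along-xor D U _   = Axis-elim refl refl
turn-xor≡along-xor U L _   = Axis-elim refl refl
turn-xor≡along-xor U R _   = Axis-elim refl refl
turn-xor≡along-xor U D _   = Axis-elim refl refl
turn-xor≡along-xor U U a≢b = ⊥-elim (a≢b refl)

∣m-n∣≡1⇒ : ∀ a c → ∣ a - c ∣ ≡ 1 → c ≡ suc a ⊎ a ≡ suc c
∣m-n∣≡1⇒ zero    c       eq = inj₁ eq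
∣m-n∣≡1⇒ (suc a) zero    eq = inj₂ eq
∣m-n∣≡1⇒ (suc a) (suc c) eq = Sum.map (cong suc) (cong suc) (∣m-n∣≡1⇒ a c eq)

Adj-sym : ∀ {p q} → Adj p q → Adj q p
Adj-sym {a , b} {c , d} eq = trans (cong₂ _+_ (∣-∣-comm c a) (∣-∣-comm d b)) eq

Adj⇒step : ∀ c w → Adj c w → ∃[ d ] w ≡ step c d
Adj⇒step (a , b) (c , d) adj with ∣ a - c ∣ in ∣a-c∣≡
... | zero with ∣m-n∣≡1⇒ b d adj
...   | inj₁ d≡1+b = U , cong₂ _,_ (sym (∣m-n∣≡0⇒m≡n ∣a-c∣≡)) d≡1+b
...   | inj₂ b≡1+d = D , cong₂ _,_ (sym (∣m-n∣≡0⇒m≡n ∣a-c∣≡)) (sym (cong pred b≡1+d))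
Adj⇒step (a , b) (c , d) adj | suc zero with ∣m-n∣≡1⇒ a c ∣a-c∣≡
...   | inj₁ c≡1+a = R , cong₂ _,_ c≡1+a (sym (∣m-n∣≡0⇒m≡n (cong pred adj)))
...   | inj₂ a≡1+c = L , cong₂ _,_ (sym (cong pred a≡1+c)) (sym (∣m-n∣≡0⇒m≡n (cong pred adj)))
Adj⇒step (a , b) (c , d) () | suc (suc _)

step-injective : ∀ {x y} d d′ → step (suc x , suc y) d ≡ step (suc x , suc y) d′ → d ≡ d′
step-injective L L _ = refl
step-injective L R ()
step-injective L D ()
step-injective L U ()
step-injective R L ()
step-injective R R _ = refl
step-injective R D ()
step-injective R U ()
step-injective D L ()
step-injective D R ()
step-injective D D _ = refl
step-injective D U ()
step-injective U L ()
step-injective U R ()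
step-injective U D ()
step-injective U U _ = refl

horizontal-step : ∀ x y d → Horizontal (x , suc y) (step (x , suc y) d) ⇔ T (isHorizontal d)
horizontal-step x y L = mk⇔ _ (λ _ → refl)
horizontal-step x y R = mk⇔ _ (λ _ → refl)
horizontal-step x y D = mk⇔ (λ ()) (λ ())
horizontal-step x y U = mk⇔ (λ ()) (λ ())

-- TurnAt H k is Turning (C k) (C (1 + k)) (C (2 + k)) by definition.
Turning : Cell → Cell → Cell → Set
Turning p c q = ExactlyOne (Horizontal p c) (Horizontal c q)

Turning-cong : ∀ {p c q p′ c′ q′} → p ≡ p′ → c ≡ c′ → q ≡ q′ →
               Turning p c q → Turning p′ c′ q′
Turning-cong refl refl refl t = t

Turning-step⇔ : ∀ x y a b →
  Turning (step (x , suc y) a) (x , suc y) (step (x , suc y) b) ⇔ T (isHorizontal a xor isHorizontal b)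
Turning-step⇔ x y a b =
  ⇔-trans (ExactlyOne-cong (⇔-trans (mk⇔ sym sym) (horizontal-step x y a)) (horizontal-step x y b))
          (⇔-sym T-xor)

-- A Hamilton cycle on more than four cells

module Cycle {m n : ℕ} (H : HamiltonCycle m n) (4<mn : 4 < m * n) where
  open HamiltonCycle H

  private
    N : ℕ
    N = m * n

    instance
      N-nonZero : NonZero N
      N-nonZero = >-nonZero (<-trans z<s 4<mn)

  C-periodic : ∀ i q → C (i + q * N) ≡ C i
  C-periodic i zero    = cong C (+-identityʳ i)
  C-periodic i (suc q) = begin
    C (i + (N + q * N)) ≡⟨ cong C (x∙yz≈xz∙y i N (q * N)) ⟩
    C (i + q * N + N)   ≡⟨ periodic (i + q * N) ⟩
    C (i + q * N)       ≡⟨ C-periodic i q ⟩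
    C i                 ∎
    where open ≡-Reasoning

  C-mod : ∀ d i → C (d + i) ≡ C (d + i % N)
  C-mod d i = begin
    C (d + i)                   ≡⟨ cong (λ j → C (d + j)) (m≡m%n+[m/n]*n i N) ⟩
    C (d + (i % N + i / N * N)) ≡⟨ cong C (+-assoc d (i % N) _) ⟨
    C (d + i % N + i / N * N)   ≡⟨ C-periodic (d + i % N) (i / N) ⟩
    C (d + i % N)               ∎
    where open ≡-Reasoning

  C-≡⇒%-≡ : ∀ {i j} → C i ≡ C j → i % N ≡ j % N
  C-≡⇒%-≡ {i} {j} Ci≡Cj = injective (i % N) (j % N) (m%n<n i N) (m%n<n j N)
    (trans (sym (C-mod 0 i)) (trans Ci≡Cj (C-mod 0 j)))

  C-shift : ∀ d {i j} → C i ≡ C j → C (d + i) ≡ C (d + j)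
  C-shift d {i} {j} Ci≡Cj =
    trans (C-mod d i) (trans (cong (λ r → C (d + r)) (C-≡⇒%-≡ Ci≡Cj)) (sym (C-mod d j)))

  C-unshift : ∀ {i j} → C (suc i) ≡ C (suc j) → C i ≡ C j
  C-unshift {i} {j} C[1+i]≡C[1+j] = begin
    C i                ≡⟨ periodic i ⟨
    C (i + N)          ≡⟨ cong C (back-one-period i) ⟨
    C (pred N + suc i) ≡⟨ C-shift (pred N) C[1+i]≡C[1+j] ⟩
    C (pred N + suc j) ≡⟨ cong C (back-one-period j) ⟩
    C (j + N)          ≡⟨ periodic j ⟩
    C j                ∎
    where
    open ≡-Reasoning
    back-one-period : ∀ i → pred N + suc i ≡ i + N
    back-one-period i = trans (+-suc (pred N) i) (trans (cong (_+ i) (suc-pred N)) (+-comm N i))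

  C-no-early-return : ∀ d k → 0 < d → d < N → C (d + k) ≢ C k
  C-no-early-return zero      k () _
  C-no-early-return d@(suc _) k _  d<N C[d+k]≡Ck =
    within-period (trans (sym (C-mod d k)) (trans C[d+k]≡Ck (C-mod 0 k)))
    where
    r = k % N
    r<N = m%n<n k N
    within-period : C (d + r) ≢ C r
    within-period C[d+r]≡Cr with d + r <? N
    ... | yes d+r<N = m≢1+n+m r (sym (injective (d + r) r d+r<N r<N C[d+r]≡Cr))
    ... | no  d+r≮N = <-irrefl s≡r s<r
      where
      N≤d+r = ≮⇒≥ d+r≮N
      s = d + r ∸ N
      s+N≡d+r : s + N ≡ d + r
      s+N≡d+r = m∸n+n≡m N≤d+r
      s<r : s < r
      s<r = +-cancelʳ-< N s r (begin-strict
        s + N ≡⟨ s+N≡d+r ⟩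
        d + r <⟨ +-monoˡ-< r d<N ⟩
        N + r ≡⟨ +-comm N r ⟩
        r + N ∎)
        where open ≤-Reasoning
      s≡r : s ≡ r
      s≡r = injective s r (<-trans s<r r<N) r<N
        (trans (sym (periodic s)) (trans (cong C s+N≡d+r) C[d+r]≡Cr))

  position : ∀ c → InGrid m n c → ∃[ k ] C (suc k) ≡ c
  position c c∈ with surjective c c∈
  ... | zero  , _ , C0≡c   = pred N , trans (cong C (suc-pred N)) (trans (periodic 0) C0≡c)
  ... | suc k , _ , C[1+k]≡c = k , C[1+k]≡c

  Step : Cell → Cell → Set
  Step u w = ∃[ k ] (C k ≡ u × C (suc k) ≡ w)

  Edge : Cell → Cell → Set
  Edge u w = Step u w ⊎ Step w u

  Edge-sym : ∀ {u w} → Edge u w → Edge w u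
  Edge-sym = Sum.swap

  Edge-inGrid : ∀ {u w} → Edge u w → InGrid m n w
  Edge-inGrid (inj₁ (k , _ , C[1+k]≡w)) = subst (InGrid m n) C[1+k]≡w (inGrid (suc k))
  Edge-inGrid (inj₂ (k , Ck≡w , _))     = subst (InGrid m n) Ck≡w (inGrid k)

  Edge-neighbours : ∀ {j u w} → C (suc j) ≡ u → Edge u w → w ≡ C j ⊎ w ≡ C (suc (suc j))
  Edge-neighbours C[1+j]≡u (inj₁ (k , Ck≡u , C[1+k]≡w)) =
    inj₂ (trans (sym C[1+k]≡w) (C-shift 1 (trans Ck≡u (sym C[1+j]≡u))))
  Edge-neighbours C[1+j]≡u (inj₂ (k , Ck≡w , C[1+k]≡u)) =
    inj₁ (trans (sym Ck≡w) (C-unshift (trans C[1+k]≡u (sym C[1+j]≡u))))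

  Edge-next : ∀ {j u w} → C (suc j) ≡ u → Edge u w → w ≢ C j → C (suc (suc j)) ≡ w
  Edge-next C[1+j]≡u e w≢Cj = [ ⊥-elim ∘ w≢Cj , sym ]′ (Edge-neighbours C[1+j]≡u e)

  private
    no-4-cycle-from : ∀ {p₀ p₁ p₂ p₃} k → C (suc k) ≡ p₀ → C (suc (suc k)) ≡ p₁ →
                      Edge p₁ p₂ → Edge p₂ p₃ → Edge p₃ p₀ → p₀ ≢ p₂ → p₁ ≢ p₃ → ⊥
    no-4-cycle-from k C₁≡p₀ C₂≡p₁ e₁₂ e₂₃ e₃₀ p₀≢p₂ p₁≢p₃ =
      C-no-early-return 4 (suc k) z<s 4<mn (trans C₅≡p₀ (sym C₁≡p₀))
      where
      C₃≡p₂ = Edge-next C₂≡p₁ e₁₂ (λ p₂≡C₁ → p₀≢p₂ (sym (trans p₂≡C₁ C₁≡p₀)))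
      C₄≡p₃ = Edge-next C₃≡p₂ e₂₃ (λ p₃≡C₂ → p₁≢p₃ (sym (trans p₃≡C₂ C₂≡p₁)))
      C₅≡p₀ = Edge-next C₄≡p₃ e₃₀ (λ p₀≡C₃ → p₀≢p₂ (trans p₀≡C₃ C₃≡p₂))

  no-4-cycle : ∀ {p₀ p₁ p₂ p₃} → Edge p₀ p₁ → Edge p₁ p₂ → Edge p₂ p₃ → Edge p₃ p₀ →
               p₀ ≢ p₂ → p₁ ≢ p₃ → ⊥
  no-4-cycle e₀₁ e₁₂ e₂₃ e₃₀ p₀≢p₂ p₁≢p₃ with position _ (Edge-inGrid e₃₀)
  ... | k , C₁≡p₀ with Edge-neighbours C₁≡p₀ e₀₁ | Edge-neighbours C₁≡p₀ (Edge-sym e₃₀)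
  ... | inj₂ p₁≡C₂ | _          =
    no-4-cycle-from k C₁≡p₀ (sym p₁≡C₂) e₁₂ e₂₃ e₃₀ p₀≢p₂ p₁≢p₃
  ... | inj₁ _     | inj₂ p₃≡C₂ =
    no-4-cycle-from k C₁≡p₀ (sym p₃≡C₂) (Edge-sym e₂₃) (Edge-sym e₁₂) (Edge-sym e₀₁) p₀≢p₂ (p₁≢p₃ ∘ sym)
  ... | inj₁ p₁≡C₀ | inj₁ p₃≡C₀ = p₁≢p₃ (trans p₁≡C₀ (sym p₃≡C₀))

  inGrid? : ∀ c → Dec (InGrid m n c)
  inGrid? (x , y) = ((1 ≤? x) ×-dec (x ≤? m)) ×-dec ((1 ≤? y) ×-dec (y ≤? n))

  Edge? : ∀ u w → Dec (Edge u w)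
  Edge? u w with inGrid? u
  ... | no  u∉ = no (u∉ ∘ Edge-inGrid ∘ Edge-sym)
  ... | yes u∈ with position u u∈
  ...   | k , C₁≡u = map′ [ before , after ]′ (Edge-neighbours C₁≡u)
                          ((w ≟ᶜ C k) ⊎-dec (w ≟ᶜ C (suc (suc k))))
    where
    _≟ᶜ_ = ≡-dec _≟_ _≟_
    before : w ≡ C k → Edge u w
    before w≡C₀ = inj₂ (k , sym w≡C₀ , C₁≡u)
    after : w ≡ C (suc (suc k)) → Edge u w
    after w≡C₂ = inj₁ (suc k , C₁≡u , sym w≡C₂)

  record Neighbourhood (c : Cell) : Set where
    field
      k            : ℕ
      at           : C (suc k) ≡ c
      before after : Dir
      before-step  : C k ≡ step c before
      after-step   : C (suc (suc k)) ≡ step c after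
      before≢after : before ≢ after

  neighbourhood : ∀ c → InGrid m n c → Neighbourhood c
  neighbourhood c c∈ with position c c∈
  ... | k , at with Adj⇒step c (C k) (subst (λ z → Adj z (C k)) at (Adj-sym {C k} (adjacent k)))
                  | Adj⇒step c (C (suc (suc k))) (subst (λ z → Adj z _) at (adjacent (suc k)))
  ... | before , before-step | after , after-step = record
    { k = k ; at = at ; before = before ; after = after
    ; before-step = before-step ; after-step = after-step
    ; before≢after = λ before≡after →
        C-no-early-return 2 k z<s (<-trans (s≤s (s≤s (s≤s z≤n))) 4<mn)
        (trans after-step (trans (cong (step c) (sym before≡after)) (sym before-step)))
    }

  private module _ {x y : ℕ} (nb : Neighbourhood (suc x , suc y)) where
    open Neighbourhood nb

    c : Cell
    c = (suc x , suc y)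

    Turn⇔Turning : Turn H c ⇔ Turning (step c before) c (step c after)
    Turn⇔Turning = mk⇔ to from
      where
      to : Turn H c → Turning (step c before) c (step c after)
      to (k′ , at′ , turning) =
        Turning-cong (trans (C-unshift same) before-step) at′ (trans (C-shift 1 same) after-step) turning
        where same = trans at′ (sym at)
      from : Turning (step c before) c (step c after) → Turn H c
      from turning = k , at , Turning-cong (sym before-step) (sym at) (sym after-step) turning

    Edge-step⇔ : ∀ d → Edge c (step c d) ⇔ (d ≡ before ⊎ d ≡ after)
    Edge-step⇔ d = mk⇔ to from
      where
      to : Edge c (step c d) → d ≡ before ⊎ d ≡ after
      to e = Sum.map (λ eq → step-injective d before (trans eq before-step))
                     (λ eq → step-injective d after (trans eq after-step))
                     (Edge-neighbours at e)
      from : d ≡ before ⊎ d ≡ after → Edge c (step c d)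
      from (inj₁ refl) = inj₂ (k , before-step , at)
      from (inj₂ refl) = inj₁ (suc k , at , after-step)

    Turn⇔one-edge-along′ : ∀ ax →
      Turn H c ⇔ ExactlyOne (Edge c (step c (backward ax))) (Edge c (step c (forward ax)))
    Turn⇔one-edge-along′ ax = begin
      Turn H c                                          ∼⟨ Turn⇔Turning ⟩
      Turning (step c before) c (step c after)          ∼⟨ Turning-step⇔ (suc x) y before after ⟩
      T (isHorizontal before xor isHorizontal after)
        ≡⟨ cong T (turn-xor≡along-xor before after before≢after ax) ⟩
      T (does (among? before after (backward ax)) xor does (among? before after (forward ax)))
        ∼⟨ T-xor ⟩
      ExactlyOne (T (does (among? before after (backward ax)))) (T (does (among? before after (forward ax))))
        ∼⟨ ExactlyOne-cong (T-does (among? _ _ _)) (T-does (among? _ _ _)) ⟩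
      ExactlyOne (backward ax ≡ before ⊎ backward ax ≡ after) (forward ax ≡ before ⊎ forward ax ≡ after)
        ∼⟨ ExactlyOne-cong (⇔-sym (Edge-step⇔ (backward ax))) (⇔-sym (Edge-step⇔ (forward ax))) ⟩
      ExactlyOne (Edge c (step c (backward ax))) (Edge c (step c (forward ax))) ∎
      where open EquationalReasoning

  Turn⇔one-edge-along : ∀ {c} → InGrid m n c → ∀ ax →
    Turn H c ⇔ ExactlyOne (Edge c (step c (backward ax))) (Edge c (step c (forward ax)))
  Turn⇔one-edge-along {zero  , _}     ((() , _) , _)
  Turn⇔one-edge-along {suc x , zero}  (_ , (() , _))
  Turn⇔one-edge-along {suc x , suc y} c∈ = Turn⇔one-edge-along′ (neighbourhood _ c∈)

  Turn-inGrid : ∀ {c} → Turn H c → InGrid m n c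
  Turn-inGrid (k , C[1+k]≡c , _) = subst (InGrid m n) C[1+k]≡c (inGrid (suc k))

  VEdge : ℕ → ℕ → Set
  VEdge x y = Edge (x , y) (x , suc y)

  HEdge : ℕ → ℕ → Set
  HEdge x y = Edge (x , y) (suc x , y)

  Turn⇔one-vertical-edge : ∀ {x y} → InGrid m n (x , suc y) →
    Turn H (x , suc y) ⇔ ExactlyOne (VEdge x y) (VEdge x (suc y))
  Turn⇔one-vertical-edge c∈ =
    ⇔-trans (Turn⇔one-edge-along c∈ vertical) (ExactlyOne-cong (mk⇔ Edge-sym Edge-sym) ⇔-refl)

  Turn⇔one-horizontal-edge : ∀ {x y} → InGrid m n (suc x , y) →
    Turn H (suc x , y) ⇔ ExactlyOne (HEdge x y) (HEdge (suc x) y)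
  Turn⇔one-horizontal-edge c∈ =
    ⇔-trans (Turn⇔one-edge-along c∈ horizontal) (ExactlyOne-cong (mk⇔ Edge-sym Edge-sym) ⇔-refl)

  Turn⇒one-vertical-edge : ∀ {x y} → Turn H (x , suc y) → ExactlyOne (VEdge x y) (VEdge x (suc y))
  Turn⇒one-vertical-edge turn = Equivalence.to (Turn⇔one-vertical-edge (Turn-inGrid turn)) turn

  Turn⇒one-horizontal-edge : ∀ {x y} → Turn H (suc x , y) → ExactlyOne (HEdge x y) (HEdge (suc x) y)
  Turn⇒one-horizontal-edge turn = Equivalence.to (Turn⇔one-horizontal-edge (Turn-inGrid turn)) turn

  ¬VEdge-bottom : ∀ x → ¬ VEdge x 0
  ¬VEdge-bottom x e with Edge-inGrid (Edge-sym e)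
  ... | _ , (() , _)

  ¬VEdge-top : ∀ x → ¬ VEdge x n
  ¬VEdge-top x e = 1+n≰n (proj₂ (proj₂ (Edge-inGrid e)))

  ¬HEdge-left : ∀ y → ¬ HEdge 0 y
  ¬HEdge-left y e with Edge-inGrid (Edge-sym e)
  ... | (() , _) , _

  column-of-turns : ∀ x → (∀ y → 1 ≤ y → y ≤ n → Turn H (x , y)) →
                    ∀ i → suc (2 * i) ≤ n → VEdge x (suc (2 * i))
  column-of-turns x turns = alternation-odd
    where
    open Alternation (¬VEdge-bottom x) (λ j j<n → Turn⇒one-vertical-edge (turns (suc j) z<s j<n))

  row-of-turns : ∀ y k → (∀ x → 1 ≤ x → x ≤ k → Turn H (x , y)) →
                 ∀ i → suc (2 * i) ≤ k → HEdge (suc (2 * i)) y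
  row-of-turns y k turns = alternation-odd
    where
    open Alternation (¬HEdge-left y) (λ j j<k → Turn⇒one-horizontal-edge (turns (suc j) z<s j<k))

  no-unit-square : ∀ x y → HEdge x y → HEdge x (suc y) → VEdge x y → VEdge (suc x) y → ⊥
  no-unit-square x y bottom top left right =
    no-4-cycle bottom right (Edge-sym top) (Edge-sym left) (λ ()) (λ ())

  vertical? : ℕ → ℕ → Bool
  vertical? x y = does (Edge? (x , y) (x , suc y))

  Turn⇔vertical?-changes : ∀ {x y} → InGrid m n (x , suc y) →
    Turn H (x , suc y) ⇔ T (vertical? x y xor vertical? x (suc y))
  Turn⇔vertical?-changes c∈ = ⇔-trans (Turn⇔one-vertical-edge c∈)
    (⇔-sym (⇔-trans T-xor (ExactlyOne-cong (T-does (Edge? _ _)) (T-does (Edge? _ _)))))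

  turn? : ∀ {x y} → InGrid m n (x , suc y) → Dec (Turn H (x , suc y))
  turn? c∈ = Dec.map (⇔-sym (Turn⇔vertical?-changes c∈)) (T? _)

  private
    straight-in? : ∀ {x y} → Dec (InGrid m n (x , suc y)) → Dec (Straight H (x , suc y))
    straight-in? (yes c∈) = map′ (c∈ ,_) proj₂ (¬? (turn? c∈))
    straight-in? (no  c∉) = no (c∉ ∘ proj₁)

  straight? : ∀ c → Dec (Straight H c)
  straight? (x , zero)  = no λ { ((_ , (() , _)) , _) }
  straight? (x , suc y) = straight-in? (inGrid? (x , suc y))

  does-straight? : ∀ {x y} → InGrid m n (x , suc y) →
    does (straight? (x , suc y)) ≡ not (vertical? x y xor vertical? x (suc y))
  does-straight? {x} {y} c∈ = does-straight-in? (inGrid? _)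
    where
    does-straight-in? : (c∈? : Dec _) → does (straight-in? c∈?) ≡ not (vertical? x y xor vertical? x (suc y))
    does-straight-in? (yes _) = refl
    does-straight-in? (no c∉) = ⊥-elim (c∉ c∈)

  ¬Straight⇒Turn : ∀ {x y} → InGrid m n (x , suc y) → ¬ Straight H (x , suc y) → Turn H (x , suc y)
  ¬Straight⇒Turn c∈ ¬straight = decidable-stable (turn? c∈) (λ ¬turn → ¬straight (c∈ , ¬turn))

  column-straights-even : ∀ {x} → 1 ≤ x → x ≤ m → parity n ≡ 0ℙ →
    parity (∑[ y < n ] toℕ (does (straight? (x , suc y)))) ≡ 0ℙ
  column-straights-even {x} 1≤x x≤m n-even = begin
    parity (∑[ y < n ] toℕ (does (straight? (x , suc y))))
      ≡⟨ cong parity (∑-cong n λ y y<n → cong toℕ (does-straight? ((1≤x , x≤m) , (z<s , y<n)))) ⟩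
    parity (agreements (vertical? x) n)
      ≡⟨ agreements-parity (vertical? x) n (dec-false (Edge? _ _) (¬VEdge-bottom x))
                                           (dec-false (Edge? _ _) (¬VEdge-top x)) ⟩
    parity n
      ≡⟨ n-even ⟩
    0ℙ ∎
    where open ≡-Reasoning

-- Counting straights

block : ℕ → ℕ → List Cell
block k l = cartesianProductWith (λ x y → (suc x , suc y)) (downFrom k) (downFrom l)

block-unique : ∀ k l → Unique (block k l)
block-unique k l = Uniqueₚ.cartesianProductWith⁺ _
  (λ eq → suc-injective (cong proj₁ eq) , suc-injective (cong proj₂ eq))
  (Uniqueₚ.downFrom⁺ k) (Uniqueₚ.downFrom⁺ l)

block-bounded : ∀ k l →
  All (λ c → (1 ≤ proj₁ c × proj₁ c ≤ k) × (1 ≤ proj₂ c × proj₂ c ≤ l)) (block k l)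
block-bounded k l = Allₚ.cartesianProductWith⁺ (setoid ℕ) (setoid ℕ) _ (downFrom k) (downFrom l)
  (λ x∈ y∈ → (z<s , ∈-downFrom⁻ x∈) , (z<s , ∈-downFrom⁻ y∈))

length-filter-block : ∀ {P : Cell → Set} (P? : Decidable P) k l →
  length (filter P? (block k l)) ≡ ∑[ x < k ] ∑[ y < l ] toℕ (does (P? (suc x , suc y)))
length-filter-block P? zero    l = refl
length-filter-block P? (suc k) l = begin
  length (filter P? (column ++ block k l))               ≡⟨ cong length (filter-++ P? column (block k l)) ⟩
  length (filter P? column ++ filter P? (block k l))     ≡⟨ length-++ (filter P? column) ⟩
  length (filter P? column) + length (filter P? (block k l))
    ≡⟨ cong₂ _+_ (length-filter-column l) (length-filter-block P? k l) ⟩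
  ∑[ y < l ] count k y + ∑[ x < k ] ∑[ y < l ] count x y ≡⟨ +-comm (∑[ y < l ] count k y) _ ⟩
  ∑[ x < suc k ] ∑[ y < l ] count x y                   ∎
  where
  open ≡-Reasoning
  count : ℕ → ℕ → ℕ
  count x y = toℕ (does (P? (suc x , suc y)))
  column : List Cell
  column = map (λ y → (suc k , suc y)) (downFrom l)
  length-filter-column : ∀ l →
    length (filter P? (map (λ y → (suc k , suc y)) (downFrom l))) ≡ ∑[ y < l ] count k y
  length-filter-column zero = refl
  length-filter-column (suc l) with does (P? (suc k , suc l))
  ... | true  = trans (cong suc (length-filter-column l)) (+-comm 1 _)
  ... | false = trans (length-filter-column l) (sym (+-identityʳ _))

module Straights {m n : ℕ} (H : HamiltonCycle m n) (4<mn : 4 < m * n)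
                 (b : ℕ) (turns : TurnColumns H b) where
  open Cycle H 4<mn

  private
    c₀ : ℕ
    c₀ = suc (2 * b)

    turns₁ : ∀ y → 1 ≤ y → y ≤ n → Turn H (c₀ , y)
    turns₁ y 1≤y y≤n = subst (λ x → Turn H (x , y)) (+-comm (2 * b) 1) (proj₁ (turns y 1≤y y≤n))

    turns₂ : ∀ y → 1 ≤ y → y ≤ n → Turn H (suc c₀ , y)
    turns₂ y 1≤y y≤n = subst (λ x → Turn H (x , y)) (+-comm (2 * b) 2) (proj₂ (turns y 1≤y y≤n))

    1≤n : 1 ≤ n
    1≤n = n≢0⇒n>0 λ n≡0 → contradiction (subst (4 <_) (trans (cong (m *_) n≡0) (*-zeroʳ m)) 4<mn) λ ()

    2b<m : 2 * b < m
    2b<m = proj₂ (proj₁ (Turn-inGrid (turns₁ 1 ≤-refl 1≤n)))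

    count : ℕ → ℕ → ℕ
    count x y = toℕ (does (straight? (suc x , suc y)))

    in-block : ∀ {x y} → x < 2 * b → y < n → InGrid m n (suc x , suc y)
    in-block x<2b y<n = (z<s , <-trans x<2b 2b<m) , (z<s , y<n)

    turn-in-block : ∀ {x y} → x < 2 * b → y < n → count x y ≡ 0 → Turn H (suc x , suc y)
    turn-in-block x<2b y<n count≡0 =
      ¬Straight⇒Turn (in-block x<2b y<n) (toℕ-does≡0⇒¬ (straight? _) count≡0)

  straights : List Cell
  straights = filter straight? (block (2 * b) n)

  straights-unique : Unique straights
  straights-unique = Uniqueₚ.filter⁺ straight? (block-unique (2 * b) n)

  straights-valid : All (λ c → (1 ≤ proj₁ c × proj₁ c ≤ 2 * b) × Straight H c) straights
  straights-valid = All.zipWith (λ (bounded , straight) → proj₁ bounded , straight)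
    (Allₚ.filter⁺ straight? (block-bounded (2 * b) n) , Allₚ.all-filter straight? (block (2 * b) n))

  length-straights : length straights ≡ ∑[ x < 2 * b ] ∑[ y < n ] count x y
  length-straights = length-filter-block straight? (2 * b) n

  length-straights-even : parity n ≡ 0ℙ → parity (length straights) ≡ 0ℙ
  length-straights-even n-even = trans (cong parity length-straights)
    (parity-∑ (2 * b) _ λ x x<2b → column-straights-even z<s (<-trans x<2b 2b<m) n-even)

  private
    two-straights-per-column-pair : parity n ≡ 0ℙ → (∀ i → i < b → ¬ TurnColumns H i) →
      ∀ i → i < b → 2 ≤ ∑[ y < n ] count (2 * i) y + ∑[ y < n ] count (suc (2 * i)) y
    two-straights-per-column-pair n-even minimal i i<b =
      ≤∧parity≢⇒< (n≢0⇒n>0 (minimal i i<b ∘ columns-turn))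
                  (λ 1ℙ≡ → contradiction (trans 1ℙ≡ pair-even) λ ())
      where
      1+2i<2b = i<k⇒1+2i<2k i<b
      pair-even : parity (∑[ y < n ] count (2 * i) y + ∑[ y < n ] count (suc (2 * i)) y) ≡ 0ℙ
      pair-even = trans (ℙ.+-homo-+ (∑[ y < n ] count (2 * i) y) _)
        (cong₂ ℙ._+_ (column-straights-even z<s (<-trans (<⇒≤ 1+2i<2b) 2b<m) n-even)
                     (column-straights-even z<s (<-trans 1+2i<2b 2b<m) n-even))
      columns-turn : ∑[ y < n ] count (2 * i) y + ∑[ y < n ] count (suc (2 * i)) y ≡ 0 → TurnColumns H i
      columns-turn sum≡0 (suc y) _ y<n =
        subst (λ x → Turn H (x , suc y)) (+-comm 1 (2 * i))
          (turn-in-block (<⇒≤ 1+2i<2b) y<n (∑≡0⇒≡0 n _ (m+n≡0⇒m≡0 _ sum≡0) y y<n)) ,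
        subst (λ x → Turn H (x , suc y)) (+-comm 2 (2 * i))
          (turn-in-block 1+2i<2b y<n (∑≡0⇒≡0 n _ (m+n≡0⇒n≡0 _ sum≡0) y y<n))

    straight-per-row-pair : ∀ p → n ≡ 2 * p →
      ∀ i → i < p → 1 ≤ ∑[ x < 2 * b ] count x (2 * i) + ∑[ x < 2 * b ] count x (suc (2 * i))
    straight-per-row-pair p n≡2p i i<p = n≢0⇒n>0 λ sum≡0 →
      no-unit-square c₀ (suc (2 * i))
        (row-of-turns _ c₀ (row-turns (<⇒≤ 1+2i<n) (m+n≡0⇒m≡0 _ sum≡0)) b ≤-refl)
        (row-of-turns _ c₀ (row-turns 1+2i<n (m+n≡0⇒n≡0 _ sum≡0)) b ≤-refl)
        (column-of-turns c₀ turns₁ i (<⇒≤ 1+2i<n))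
        (column-of-turns (suc c₀) turns₂ i (<⇒≤ 1+2i<n))
      where
      1+2i<n = subst (suc (2 * i) <_) (sym n≡2p) (i<k⇒1+2i<2k i<p)
      row-turns : ∀ {y} → y < n → ∑[ x < 2 * b ] count x y ≡ 0 →
                  ∀ x → 1 ≤ x → x ≤ c₀ → Turn H (x , suc y)
      row-turns y<n row≡0 (suc x) _ 1+x≤c₀ with m≤n⇒m<n∨m≡n (s≤s⁻¹ 1+x≤c₀)
      ... | inj₁ x<2b = turn-in-block x<2b y<n (∑≡0⇒≡0 (2 * b) _ row≡0 x x<2b)
      ... | inj₂ refl = turns₁ _ z<s y<n

  2b≤length-straights : parity n ≡ 0ℙ → (∀ i → i < b → ¬ TurnColumns H i) → 2 * b ≤ length straights
  2b≤length-straights n-even minimal = begin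
    2 * b                                              ≡⟨ *-comm 2 b ⟩
    b * 2                                              ≤⟨ *≤∑ b 2 _ (two-straights-per-column-pair n-even minimal) ⟩
    ∑[ i < b ] (column (2 * i) + column (suc (2 * i))) ≡⟨ ∑-pairs b column ⟨
    ∑[ x < 2 * b ] column x                            ≡⟨ length-straights ⟨
    length straights                                   ∎
    where
    open ≤-Reasoning
    column : ℕ → ℕ
    column x = ∑[ y < n ] count x y

  half≤length-straights : ∀ p → n ≡ 2 * p → p ≤ length straights
  half≤length-straights p n≡2p = begin
    p                                            ≡⟨ *-identityʳ p ⟨
    p * 1                                        ≤⟨ *≤∑ p 1 _ (straight-per-row-pair p n≡2p) ⟩
    ∑[ i < p ] (row (2 * i) + row (suc (2 * i))) ≡⟨ ∑-pairs p row ⟨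
    ∑[ y < 2 * p ] row y                         ≡⟨ cong (λ k → ∑< k row) n≡2p ⟨
    ∑[ y < n ] row y                             ≡⟨ ∑-comm (2 * b) n count ⟨
    ∑[ x < 2 * b ] ∑[ y < n ] count x y          ≡⟨ length-straights ⟨
    length straights                             ∎
    where
    open ≤-Reasoning
    row : ℕ → ℕ
    row y = ∑[ x < 2 * b ] count x y

lemma21 : (m n : ℕ) → n < m → n % 4 ≡ 2 →
    (H : HamiltonCycle m n) → (b : ℕ) →
    TurnColumns H b → (∀ b′ → b′ < b → ¬ TurnColumns H b′) →
    ∃[ L ] (Unique L
      × All (λ c → (1 ≤ proj₁ c × proj₁ c ≤ 2 * b) × Straight H c) L
      × (2 * b) ⊔ (n / 2 + 1) ≤ length L)
lemma21 m n n<m n%4≡2 H b turns minimal =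
  straights , straights-unique , straights-valid ,
  ⊔-lub (2b≤length-straights n-even minimal) half+1≤length-straights
  where
  n≡2[n/2] : n ≡ 2 * (n / 2)
  n≡2[n/2] = proj₁ (n%4≡2⇒n≡2*odd n n%4≡2)
  n/2-odd : parity (n / 2) ≡ 1ℙ
  n/2-odd = proj₂ (n%4≡2⇒n≡2*odd n n%4≡2)
  n-even : parity n ≡ 0ℙ
  n-even = trans (cong parity n≡2[n/2]) (parity-2* (n / 2))
  2≤n : 2 ≤ n
  2≤n = subst (_≤ n) n%4≡2 (m%n≤m n 4)
  4<mn : 4 < m * n
  4<mn = ≤-trans (n≤1+n 5) (*-mono-≤ (≤-<-trans 2≤n n<m) 2≤n)
  open Straights H 4<mn b turns
  half+1≤length-straights : n / 2 + 1 ≤ length straights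
  half+1≤length-straights = subst (_≤ length straights) (+-comm 1 (n / 2))
    (≤∧parity≢⇒< (half≤length-straights (n / 2) n≡2[n/2]) λ parities≡ →
      contradiction (trans (sym n/2-odd) (trans parities≡ (length-straights-even n-even))) λ ())
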